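{- Let $q$ be an odd prime power and let $\ell,d$ be positive integers with $0<d<2\ell$ and $\gcd(\ell,d)=1$. (i) There is no $a\in\mathbb{F}_{q^{2\ell}}^*$ with $a+a^{q^\ell}=a+a^{q^d}=0$ if and only if $\ell+d$ is odd. (ii) If there is no $a\in\mathbb{F}_{q^{2\ell}}^*$ with $a+a^{q^\ell}=a+a^{q^d}=0$, then an element $\beta\in\mathbb{F}_{q^{2\ell}}^*$ satisfies $\beta^{\frac{q^{2\ell}-1}{\gcd(q^\ell+1,q^d+1)}}\neq 1$ if and only if $\beta$ is a nonsquare in $\mathbb{F}_{q^{2\ell}}$. -}

module Defs where

open import Level using (Level; _⊔_)
open import Data.Nat using (ℕ; zero; suc; _∸_; _^_; _/_; _≤_; NonZero; ≢-nonZero)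
import Data.Nat as N
open import Data.Nat.GCD using (gcd; gcd[m,n]≢0)
open import Data.Nat.Primality using (Prime)
open import Data.Fin using (Fin)
open import Data.Sum using (inj₁)
open import Data.Product using (Σ; ∃; _×_)
open import Relation.Nullary using (¬_)
open import Relation.Binary.PropositionalEquality using (_≡_) renaming (setoid to ≡-setoid)
open import Function.Bundles using (Inverse)
open import Algebra.Bundles using (CommutativeRing)

IsPrimePower : ℕ → Set
IsPrimePower q = Σ ℕ λ p → Σ ℕ λ k → Prime p × 1 ≤ k × q ≡ p ^ k

module _ {c ℓ : Level} (R : CommutativeRing c ℓ) where
  open CommutativeRing R

  pow : Carrier → ℕ → Carrier
  pow x zero    = 1#
  pow x (suc n) = x * pow x n

  IsField : Set (c ⊔ ℓ)
  IsField = (¬ (0# ≈ 1#)) × (∀ x → ¬ (x ≈ 0#) → ∃ λ y → x * y ≈ 1#)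

  HasCard : ℕ → Set (c ⊔ ℓ)
  HasCard N = Inverse (≡-setoid (Fin N)) setoid

  IsSquare : Carrier → Set (c ⊔ ℓ)
  IsSquare β = ∃ λ γ → γ * γ ≈ β

  ExistsA : ℕ → ℕ → ℕ → Set (c ⊔ ℓ)
  ExistsA q l d = ∃ λ a → (¬ (a ≈ 0#)) × (a + pow a (q ^ l) ≈ 0#) × (a + pow a (q ^ d) ≈ 0#)

expo : ℕ → ℕ → ℕ → ℕ
expo q l d = _/_ (q ^ (2 N.* l) ∸ 1) (gcd (suc (q ^ l)) (suc (q ^ d)))
  {{≢-nonZero (gcd[m,n]≢0 (suc (q ^ l)) (suc (q ^ d)) (inj₁ λ ()))}}

module Submission where

-- Write q^(2ℓ) = 1 + 2h. In a field of odd order, pairing each nonzero x with β/x proves Euler's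
-- criterion: for β ≠ 0, β^h = 1 if β is a square and β^h = -1 otherwise (the fixed points ±√β of
-- the pairing contribute the sign, and β = 1 gives Wilson's theorem).
-- If a ≠ 0 and a^(q^ℓ) = a^(q^d) = -a, computing a^(q^(ℓd)) in two ways gives (-1)^d a = (-1)^ℓ a,
-- so ℓ ≡ d (mod 2); as gcd (ℓ, d) = 1, ℓ and d are then both odd. Conversely q - 1 divides h, so a
-- nonsquare η yields a = η^(h/(q-1)) with a^(q-1) = η^h = -1, i.e. a^(q^k) = (-1)^k a, which is -a
-- for k = ℓ, d when both are odd.
-- When ℓ + d is odd, q^ℓ ≡ -1 ≡ q^d modulo g = gcd (q^ℓ + 1, q^d + 1) forces g ∣ 2, so g = 2, the
-- exponent in (ii) is h, and (ii) is Euler's criterion.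

open import Defs
open import Level using (Level; _⊔_)
open import Data.Nat.Base using (ℕ; zero; suc; parity)
import Data.Nat.Base as ℕ
import Data.Nat.Properties as ℕₚ
open import Data.Nat.GCD using (gcd)
open import Data.Nat.Divisibility using (_∣_)
open import Data.Parity.Base using (Parity; 0ℙ; 1ℙ) renaming (_+_ to _+ℙ_; _*_ to _*ℙ_)
open import Data.Parity.Properties using (+-homo-+; *-homo-*; p+p≡0ℙ)
open import Data.Fin.Base using (Fin; punchOut)
open import Data.Fin.Properties using (punchOut-injective; injective⇒≤)
open import Data.Product using (_×_; ∃; _,_; proj₁; proj₂)
open import Function using (_∘_)
open import Function.Bundles using (_⇔_; mk⇔; Equivalence; Inverse)
open import Function.Properties.Equivalence using () renaming (sym to ⇔-sym; trans to ⇔-trans)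
open import Relation.Nullary using (¬_; contradiction)
open import Relation.Unary using (Pred; _≐_)
open import Relation.Binary.Core using (Rel)
open import Relation.Binary.Bundles using (Setoid)
open import Relation.Binary.Definitions using (Symmetric; _Respectsʳ_)
open import Relation.Binary.PropositionalEquality using (_≡_; _≢_)
import Relation.Binary.PropositionalEquality as ≡
open import Algebra.Bundles using (CommutativeMonoid; Semiring; CommutativeRing)

module _ where
  open import Data.Nat using (_+_; _*_; _^_; _%_)
  open import Data.Nat.Divisibility using (divides; ∣-refl; ∣m∣n⇒∣m+n)
  open import Data.Nat.Tactic.RingSolver using (solve-∀)
  open ≡ using (refl; sym; trans; cong; cong₂; subst; module ≡-Reasoning)

  parity≡0ℙ⇒2∣ : ∀ n → parity n ≡ 0ℙ → 2 ∣ n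
  parity≡0ℙ⇒2∣ zero          _  = divides 0 refl
  parity≡0ℙ⇒2∣ (suc (suc n)) eq = ∣m∣n⇒∣m+n ∣-refl (parity≡0ℙ⇒2∣ n eq)

  ¬2∣⇒parity≡1ℙ : ∀ n → ¬ 2 ∣ n → parity n ≡ 1ℙ
  ¬2∣⇒parity≡1ℙ n 2∤n with parity n in eq
  ... | 0ℙ = contradiction (parity≡0ℙ⇒2∣ n eq) 2∤n
  ... | 1ℙ = refl

  parity≡1ℙ⇒≡1+s+s : ∀ n → parity n ≡ 1ℙ → ∃ λ s → n ≡ suc (s + s)
  parity≡1ℙ⇒≡1+s+s 1             _  = 0 , refl
  parity≡1ℙ⇒≡1+s+s (suc (suc n)) eq with parity≡1ℙ⇒≡1+s+s n eq
  ... | s , refl = suc s , cong (λ m → suc (suc m)) (sym (ℕₚ.+-suc s s))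

  parity[n+n]≡0ℙ : ∀ n → parity (n + n) ≡ 0ℙ
  parity[n+n]≡0ℙ n = trans (+-homo-+ n n) (p+p≡0ℙ (parity n))

  parity-^ : ∀ {q} → parity q ≡ 1ℙ → ∀ k → parity (q ^ k) ≡ 1ℙ
  parity-^     _  zero    = refl
  parity-^ {q} pq (suc k) = trans (*-homo-* q (q ^ k)) (cong₂ _*ℙ_ pq (parity-^ pq k))

  parity≡1ℙ⇒2∣1+ : ∀ n → parity n ≡ 1ℙ → 2 ∣ suc n
  parity≡1ℙ⇒2∣1+ n eq = parity≡0ℙ⇒2∣ (suc n) (trans (+-homo-+ 1 n) (cong (1ℙ +ℙ_) eq))

  n%2≡1⇒parity≡1ℙ : ∀ n → n % 2 ≡ 1 → parity n ≡ 1ℙ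
  n%2≡1⇒parity≡1ℙ 1             _  = refl
  n%2≡1⇒parity≡1ℙ (suc (suc n)) eq = n%2≡1⇒parity≡1ℙ n eq

  parity≡1ℙ⇒n%2≡1 : ∀ n → parity n ≡ 1ℙ → n % 2 ≡ 1
  parity≡1ℙ⇒n%2≡1 1             _  = refl
  parity≡1ℙ⇒n%2≡1 (suc (suc n)) eq = parity≡1ℙ⇒n%2≡1 n eq

  [m+n]%2≡1⇔parity≢ : ∀ m n → (m + n) % 2 ≡ 1 ⇔ parity m ≢ parity n
  [m+n]%2≡1⇔parity≢ m n = mk⇔
    (λ eq → p+p′≡1ℙ⇒p≢p′ (trans (sym (+-homo-+ m n)) (n%2≡1⇒parity≡1ℙ (m + n) eq)))
    (λ p≢p′ → parity≡1ℙ⇒n%2≡1 (m + n) (trans (+-homo-+ m n) (p≢p′⇒p+p′≡1ℙ p≢p′)))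
    where
    p+p′≡1ℙ⇒p≢p′ : ∀ {p p′} → p +ℙ p′ ≡ 1ℙ → p ≢ p′
    p+p′≡1ℙ⇒p≢p′ {p} eq refl with trans (sym (p+p≡0ℙ p)) eq
    ... | ()
    p≢p′⇒p+p′≡1ℙ : ∀ {p p′} → p ≢ p′ → p +ℙ p′ ≡ 1ℙ
    p≢p′⇒p+p′≡1ℙ {0ℙ} {0ℙ} ne = contradiction refl ne
    p≢p′⇒p+p′≡1ℙ {0ℙ} {1ℙ} _  = refl
    p≢p′⇒p+p′≡1ℙ {1ℙ} {0ℙ} _  = refl
    p≢p′⇒p+p′≡1ℙ {1ℙ} {1ℙ} ne = contradiction refl ne

  1+n+n≢m+m : ∀ n m → suc (n + n) ≢ m + m
  1+n+n≢m+m n m eq = contradiction (trans (sym parity[1+n+n]≡1ℙ) (trans (cong parity eq) (parity[n+n]≡0ℙ m))) λ ()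
    where
    parity[1+n+n]≡1ℙ : parity (suc (n + n)) ≡ 1ℙ
    parity[1+n+n]≡1ℙ = trans (+-homo-+ 1 (n + n)) (cong (1ℙ +ℙ_) (parity[n+n]≡0ℙ n))

  n+n≡m+m⇒n≡m : ∀ {n m} → n + n ≡ m + m → n ≡ m
  n+n≡m+m⇒n≡m {n} {m} eq = ℕₚ.*-cancelˡ-≡ n m 2
    (trans (cong (n +_) (ℕₚ.+-identityʳ n)) (trans eq (sym (cong (m +_) (ℕₚ.+-identityʳ m)))))

  qˡᵈ≡qᵈˡ : ∀ q l d → (q ^ l) ^ d ≡ (q ^ d) ^ l
  qˡᵈ≡qᵈˡ q l d = trans (ℕₚ.^-*-assoc q l d) (trans (cong (q ^_) (ℕₚ.*-comm l d)) (sym (ℕₚ.^-*-assoc q d l)))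

  [1+m]^n≡1+m*k : ∀ m n → ∃ λ k → suc m ^ n ≡ suc (m * k)
  [1+m]^n≡1+m*k m zero = 0 , cong suc (sym (ℕₚ.*-zeroʳ m))
  [1+m]^n≡1+m*k m (suc n) with k , eq ← [1+m]^n≡1+m*k m n =
    k + suc (m * k) , trans (cong (suc m *_) eq) (expand m k)
    where
    expand : ∀ m k → suc m * suc (m * k) ≡ suc (m * (k + suc (m * k)))
    expand = solve-∀

  -- h = e * (s + s) exhibits (q^(2l) - 1) / 2 as a multiple of q - 1 = s + s.
  [1+s+s]^[2*l]≡1+h+h : ∀ s l → ∃ λ e → suc (s + s) ^ (2 * l) ≡ suc (e * (s + s) + e * (s + s))
  [1+s+s]^[2*l]≡1+h+h s l with k , eq ← [1+m]^n≡1+m*k ((s + s) * (suc s + suc s)) l =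
    suc s * k , (begin
      suc (s + s) ^ (2 * l)                          ≡⟨ ℕₚ.^-*-assoc (suc (s + s)) 2 l ⟨
      (suc (s + s) ^ 2) ^ l                          ≡⟨ cong (_^ l) (square s) ⟩
      suc ((s + s) * (suc s + suc s)) ^ l            ≡⟨ eq ⟩
      suc ((s + s) * (suc s + suc s) * k)            ≡⟨ cong suc (regroup s k) ⟩
      suc (suc s * k * (s + s) + suc s * k * (s + s)) ∎)
    where
    open ≡-Reasoning
    square : ∀ s → suc (s + s) * (suc (s + s) * 1) ≡ suc ((s + s) * (suc s + suc s))
    square = solve-∀
    regroup : ∀ s k → (s + s) * (suc s + suc s) * k ≡ suc s * k * (s + s) + suc s * k * (s + s)
    regroup = solve-∀

module RingPowers {c ℓ} (R : CommutativeRing c ℓ) where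
  open CommutativeRing R
  open import Data.Nat using () renaming (_^_ to _^ℕ_; _*_ to _*ℕ_)
  open import Algebra.Properties.Ring ring using (-1*x≈-x; -‿involutive)
  open import Algebra.Definitions.RawSemiring (Semiring.rawSemiring semiring) using (_^_) public
  open import Algebra.Properties.Semiring.Exp semiring using (^-assocʳ; ^-congˡ)
  open import Algebra.Properties.CommutativeSemiring.Exp commutativeSemiring using (^-distrib-*)
  open import Relation.Binary.Reasoning.Setoid setoid

  pow≡^ : ∀ x n → pow R x n ≡ x ^ n
  pow≡^ x zero    = ≡.refl
  pow≡^ x (suc n) = ≡.cong (x *_) (pow≡^ x n)

  1^n≈1 : ∀ n → 1# ^ n ≈ 1#
  1^n≈1 zero    = refl
  1^n≈1 (suc n) = trans (*-identityˡ _) (1^n≈1 n)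

  sign : Parity → Carrier
  sign 0ℙ = 1#
  sign 1ℙ = - 1#

  [-1]^n≈sign[parity[n]] : ∀ n → (- 1#) ^ n ≈ sign (parity n)
  [-1]^n≈sign[parity[n]] zero          = refl
  [-1]^n≈sign[parity[n]] 1             = *-identityʳ (- 1#)
  [-1]^n≈sign[parity[n]] (suc (suc n)) = begin
    - 1# * (- 1# * (- 1#) ^ n) ≈⟨ *-assoc (- 1#) (- 1#) _ ⟨
    (- 1# * - 1#) * (- 1#) ^ n ≈⟨ *-congʳ (trans (-1*x≈-x (- 1#)) (-‿involutive 1#)) ⟩
    1# * (- 1#) ^ n            ≈⟨ *-identityˡ _ ⟩
    (- 1#) ^ n                 ≈⟨ [-1]^n≈sign[parity[n]] n ⟩
    sign (parity n)            ∎

  [-x]^n≈[-1]^n*x^n : ∀ x n → (- x) ^ n ≈ (- 1#) ^ n * x ^ n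
  [-x]^n≈[-1]^n*x^n x n = trans (^-congˡ n (sym (-1*x≈-x x))) (^-distrib-* (- 1#) x n)

  x^Q≈-x⇒x^Qᵏ≈[-1]ᵏ*x : ∀ {x Q} → parity Q ≡ 1ℙ → x ^ Q ≈ - x → ∀ k → x ^ (Q ^ℕ k) ≈ (- 1#) ^ k * x
  x^Q≈-x⇒x^Qᵏ≈[-1]ᵏ*x {x}     _      _       zero    = trans (*-identityʳ x) (sym (*-identityˡ x))
  x^Q≈-x⇒x^Qᵏ≈[-1]ᵏ*x {x} {Q} odd-Q x^Q≈-x (suc k) = begin
    x ^ (Q *ℕ Q ^ℕ k)                   ≈⟨ ^-assocʳ x Q (Q ^ℕ k) ⟨
    (x ^ Q) ^ (Q ^ℕ k)                   ≈⟨ ^-congˡ (Q ^ℕ k) x^Q≈-x ⟩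
    (- x) ^ (Q ^ℕ k)                     ≈⟨ [-x]^n≈[-1]^n*x^n x (Q ^ℕ k) ⟩
    (- 1#) ^ (Q ^ℕ k) * x ^ (Q ^ℕ k)     ≈⟨ *-cong [-1]^Qᵏ≈-1 (x^Q≈-x⇒x^Qᵏ≈[-1]ᵏ*x odd-Q x^Q≈-x k) ⟩
    - 1# * ((- 1#) ^ k * x)              ≈⟨ *-assoc (- 1#) _ x ⟨
    (- 1#) ^ suc k * x                   ∎
    where
    [-1]^Qᵏ≈-1 : (- 1#) ^ (Q ^ℕ k) ≈ - 1#
    [-1]^Qᵏ≈-1 = trans ([-1]^n≈sign[parity[n]] (Q ^ℕ k)) (reflexive (≡.cong sign (parity-^ odd-Q k)))

module _ where
  open import Data.Nat.Divisibility using (∣-antisym)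
  open import Data.Nat.GCD using (gcd[m,n]∣m; gcd[m,n]∣n; gcd-greatest)
  open import Data.Nat using (_*_; _^_)
  open ≡ using (refl; sym; trans; cong; cong₂; subst)
  open import Data.Integer.Base using (+_; -1ℤ; _-_; ∣_∣) renaming (_*_ to _*ℤ_; _+_ to _+ℤ_)
  open import Data.Integer.Properties using (+-*-commutativeRing; pos-*)
  open import Data.Integer.Divisibility.Signed
    using (divides; ∣-refl; ∣-trans; ∣ᵤ⇒∣; ∣⇒∣ᵤ; ∣m∣n⇒∣m+n; ∣m∣n⇒∣m-n; ∣n⇒∣m*n) renaming (_∣_ to _∣ℤ_)
  import Data.Integer.Tactic.RingSolver as ℤ-Solver
  open RingPowers +-*-commutativeRing using (sign; [-1]^n≈sign[parity[n]]) renaming (_^_ to _^ℤ_)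
  open import Algebra.Properties.Semiring.Exp (CommutativeRing.semiring +-*-commutativeRing) using (^-assocʳ)

  +[m^n]≡+m^n : ∀ m n → + (m ^ n) ≡ (+ m) ^ℤ n
  +[m^n]≡+m^n m zero    = refl
  +[m^n]≡+m^n m (suc n) = trans (pos-* m (m ^ n)) (cong (+ m *ℤ_) (+[m^n]≡+m^n m n))

  x-y∣xᵏ-yᵏ : ∀ x y k → (x - y) ∣ℤ (x ^ℤ k - y ^ℤ k)
  x-y∣xᵏ-yᵏ x y zero    = divides (+ 0) refl
  x-y∣xᵏ-yᵏ x y (suc k) = subst ((x - y) ∣ℤ_) (sym (factor x y (x ^ℤ k) (y ^ℤ k)))
    (∣m∣n⇒∣m+n (∣n⇒∣m*n x (x-y∣xᵏ-yᵏ x y k)) (∣n⇒∣m*n (y ^ℤ k) ∣-refl))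
    where
    factor : ∀ x y X Y → x *ℤ X - y *ℤ Y ≡ x *ℤ (X - Y) +ℤ Y *ℤ (x - y)
    factor = ℤ-Solver.solve-∀

  ∣sign-sign⇒∣2 : ∀ {k p p′} → p ≢ p′ → k ∣ℤ (sign p - sign p′) → ∣ k ∣ ∣ 2
  ∣sign-sign⇒∣2 {p = 0ℙ} {0ℙ} p≢p′ _ = contradiction refl p≢p′
  ∣sign-sign⇒∣2 {p = 0ℙ} {1ℙ} _    k∣ = ∣⇒∣ᵤ k∣
  ∣sign-sign⇒∣2 {p = 1ℙ} {0ℙ} _    k∣ = ∣⇒∣ᵤ k∣
  ∣sign-sign⇒∣2 {p = 1ℙ} {1ℙ} p≢p′ _ = contradiction refl p≢p′

  gcd[1+qˡ,1+qᵈ]≡2 : ∀ {q} l d → parity q ≡ 1ℙ → parity l ≢ parity d → gcd (suc (q ^ l)) (suc (q ^ d)) ≡ 2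
  gcd[1+qˡ,1+qᵈ]≡2 {q} l d odd-q l≢d = ∣-antisym g∣2 2∣g
    where
    g = gcd (suc (q ^ l)) (suc (q ^ d))

    2∣g : 2 ∣ g
    2∣g = gcd-greatest (parity≡1ℙ⇒2∣1+ (q ^ l) (parity-^ odd-q l)) (parity≡1ℙ⇒2∣1+ (q ^ d) (parity-^ odd-q d))

    g∣qᵐⁿ-[-1]ⁿ : ∀ m n → g ∣ suc (q ^ m) → + g ∣ℤ ((+ q) ^ℤ (m * n) - -1ℤ ^ℤ n)
    g∣qᵐⁿ-[-1]ⁿ m n g∣ = subst (λ z → + g ∣ℤ (z - -1ℤ ^ℤ n)) (^-assocʳ (+ q) m n)
      (∣-trans (subst (+ g ∣ℤ_) +[1+qᵐ]≡qᵐ--1 (∣ᵤ⇒∣ g∣)) (x-y∣xᵏ-yᵏ ((+ q) ^ℤ m) -1ℤ n))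
      where
      +[1+qᵐ]≡qᵐ--1 : + suc (q ^ m) ≡ (+ q) ^ℤ m - -1ℤ
      +[1+qᵐ]≡qᵐ--1 = trans (cong +_ (ℕₚ.+-comm 1 (q ^ m))) (cong (_+ℤ + 1) (+[m^n]≡+m^n q m))

    g∣signs : + g ∣ℤ (sign (parity l) - sign (parity d))
    g∣signs = subst (+ g ∣ℤ_) (trans (cancel ((+ q) ^ℤ (l * d)) (-1ℤ ^ℤ d) (-1ℤ ^ℤ l)) (cong₂ _-_ signˡ signᵈ))
      (∣m∣n⇒∣m-n (g∣qᵐⁿ-[-1]ⁿ l d (gcd[m,n]∣m (suc (q ^ l)) (suc (q ^ d))))
                 (subst (λ k → + g ∣ℤ ((+ q) ^ℤ k - -1ℤ ^ℤ l)) (ℕₚ.*-comm d l)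
                        (g∣qᵐⁿ-[-1]ⁿ d l (gcd[m,n]∣n (suc (q ^ l)) (suc (q ^ d))))))
      where
      signˡ = [-1]^n≈sign[parity[n]] l
      signᵈ = [-1]^n≈sign[parity[n]] d
      cancel : ∀ A s t → (A - s) - (A - t) ≡ t - s
      cancel = ℤ-Solver.solve-∀

    g∣2 : g ∣ 2
    g∣2 = ∣sign-sign⇒∣2 l≢d g∣signs

injective⇒¬avoids : ∀ {n} {f : Fin n → Fin n} → (∀ {i j} → f i ≡ f j → i ≡ j) → ∀ u → ¬ (∀ i → f i ≢ u)
injective⇒¬avoids {suc n} {f} f-injective u f≢u = ℕₚ.<-irrefl ≡.refl (injective⇒≤ punchOut-u∘f-injective)
  where
  punchOut-u∘f : Fin (suc n) → Fin n
  punchOut-u∘f i = punchOut (f≢u i ∘ ≡.sym)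
  punchOut-u∘f-injective : ∀ {i j} → punchOut-u∘f i ≡ punchOut-u∘f j → i ≡ j
  punchOut-u∘f-injective {i} {j} = f-injective ∘ punchOut-injective {i = u} (f≢u i ∘ ≡.sym) (f≢u j ∘ ≡.sym)

module PerfectMatchings {a ℓ} (S : Setoid a ℓ) where
  open Setoid S renaming (Carrier to A)
  open import Data.Nat using (_+_; _≤_; s≤s)
  open import Data.List.Base using (List; []; _∷_; _++_; length)
  open import Data.List.Membership.Setoid S using (_∈_)
  open import Data.List.Membership.Setoid.Properties using (∈-∃++; ∈-resp-≈; All[≉]⇒∉)
  open import Data.List.Relation.Unary.Any using (here; there)
  open import Data.List.Relation.Unary.All using (All; []; _∷_)
  open import Data.List.Relation.Unary.AllPairs using (_∷_)
  open import Data.List.Relation.Unary.Unique.Setoid S using (Unique)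
  open import Data.List.Relation.Binary.Permutation.Setoid S using (_↭_; ↭-refl; ↭-prep; ↭-trans; ↭-sym; ↭-reflexive-≋)
  open import Data.List.Relation.Binary.Permutation.Setoid.Properties S
    using (shift; ∈-resp-↭; Unique-resp-↭; xs↭ys⇒|xs|≡|ys|)
  open import Data.Product using (uncurry)

  record Enumerates (P : Pred A ℓ) (xs : List A) : Set (a ⊔ ℓ) where
    field
      unique   : Unique xs
      sound    : ∀ {x} → x ∈ xs → P x
      complete : ∀ {x} → P x → x ∈ xs

  open Enumerates

  private
    variable
      P Q : Pred A ℓ
      x y : A
      xs : List A

  enumerates-≐ : P ≐ Q → Enumerates P xs → Enumerates Q xs
  enumerates-≐ (P⊆Q , Q⊆P) e = record { unique = unique e ; sound = P⊆Q ∘ sound e ; complete = complete e ∘ Q⊆P }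

  enumerates-resp-↭ : ∀ {ys} → xs ↭ ys → Enumerates P xs → Enumerates P ys
  enumerates-resp-↭ xs↭ys e = record
    { unique   = Unique-resp-↭ xs↭ys (unique e)
    ; sound    = sound e ∘ ∈-resp-↭ (↭-sym xs↭ys)
    ; complete = ∈-resp-↭ xs↭ys ∘ complete e
    }

  enumerates-∷⁻ : Enumerates P (x ∷ xs) → Enumerates (λ z → P z × z ≉ x) xs
  enumerates-∷⁻ {P = P} {x = x} {xs = xs} e with x≉xs ∷ unique-xs ← unique e = record
    { unique   = unique-xs
    ; sound    = λ z∈xs → sound e (there z∈xs) , λ z≈x → All[≉]⇒∉ S x≉xs (∈-resp-≈ S z≈x z∈xs)
    ; complete = tail
    }
    where
    tail : ∀ {z} → P z × z ≉ x → z ∈ xs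
    tail (Pz , z≉x) with complete e Pz
    ... | here z≈x    = contradiction z≈x z≉x
    ... | there z∈xs = z∈xs

  ∈⇒↭∷ : x ∈ xs → ∃ λ ys → xs ↭ x ∷ ys
  ∈⇒↭∷ x∈xs with hs , ts , _ , x≈w , xs≋ ← ∈-∃++ S x∈xs =
    hs ++ ts , ↭-trans (↭-reflexive-≋ xs≋) (shift (sym x≈w) hs ts)

  enumerates-remove : Enumerates P xs → P x → ∃ λ ys → xs ↭ x ∷ ys × Enumerates (λ z → P z × z ≉ x) ys
  enumerates-remove e Px with ys , xs↭x∷ys ← ∈⇒↭∷ (complete e Px) =
    ys , xs↭x∷ys , enumerates-∷⁻ (enumerates-resp-↭ xs↭x∷ys e)

  flatten : List (A × A) → List A
  flatten []             = []
  flatten ((x , y) ∷ ps) = x ∷ y ∷ flatten ps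

  length-flatten : ∀ ps → length (flatten ps) ≡ length ps + length ps
  length-flatten []       = ≡.refl
  length-flatten (_ ∷ ps) = ≡.cong suc (≡.trans (≡.cong suc (length-flatten ps)) (≡.sym (ℕₚ.+-suc _ _)))

  record PerfectMatching (_~_ : Rel A ℓ) (xs : List A) : Set (a ⊔ ℓ) where
    field
      pairs     : List (A × A)
      ↭-flatten : xs ↭ flatten pairs
      matched   : All (uncurry _~_) pairs

    length≡ : length xs ≡ length pairs + length pairs
    length≡ = ≡.trans (xs↭ys⇒|xs|≡|ys| ↭-flatten) (length-flatten pairs)

  Closed : Rel A ℓ → Pred A ℓ → Set (a ⊔ ℓ)
  Closed _~_ P = ∀ {x} → P x → ∃ λ y → P y × x ~ y

  module _ {_~_ : Rel A ℓ}
           (~-sym : Symmetric _~_)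
           (~-functional : ∀ {x y z} → x ~ y → x ~ z → y ≈ z)
           (~-irrefl : ∀ {x y} → x ~ y → x ≉ y)
           (~-respʳ : _~_ Respectsʳ _≈_)
    where

    closed-∖pair : x ~ y → Closed _~_ P → Closed _~_ (λ z → (P z × z ≉ x) × z ≉ y)
    closed-∖pair x~y closed ((Pz , z≉x) , z≉y) with w , Pw , z~w ← closed Pz =
      w , ((Pw , λ w≈x → z≉y (~-functional (~-sym (~-respʳ w≈x z~w)) x~y))
                , λ w≈y → z≉x (~-functional (~-sym (~-respʳ w≈y z~w)) (~-sym x~y)))
        , z~w

    private
      match : ∀ n xs → length xs ≤ n → Enumerates P xs → Closed _~_ P → PerfectMatching _~_ xs
      match _       []       _             _ _      = record { pairs = [] ; ↭-flatten = ↭-refl ; matched = [] }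
      match (suc n) (x ∷ xs) (s≤s |xs|≤n) e closed
        with y , Py , x~y ← closed (sound e (here refl))
        with ys , xs↭y∷ys , e′ ← enumerates-remove (enumerates-∷⁻ e) (Py , λ y≈x → ~-irrefl x~y (sym y≈x)) =
        record
          { pairs     = (x , y) ∷ pairs
          ; ↭-flatten = ↭-prep x (↭-trans xs↭y∷ys (↭-prep y ↭-flatten))
          ; matched   = x~y ∷ matched
          }
        where
        |ys|≤n : length ys ≤ n
        |ys|≤n = ℕₚ.≤-trans (ℕₚ.n≤1+n _) (≡.subst (_≤ n) (xs↭ys⇒|xs|≡|ys| xs↭y∷ys) |xs|≤n)
        open PerfectMatching (match n ys |ys|≤n e′ (closed-∖pair x~y closed))

    perfectMatching : Enumerates P xs → Closed _~_ P → PerfectMatching _~_ xs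
    perfectMatching {xs = xs} = match (length xs) xs ℕₚ.≤-refl

module MatchingProducts {c ℓ} (M : CommutativeMonoid c ℓ) where
  open CommutativeMonoid M
  open import Data.List.Base using (List; []; _∷_; foldr; length)
  open import Data.List.Relation.Unary.All as All using (All; []; _∷_)
  open import Data.List.Relation.Binary.Permutation.Setoid.Properties setoid using (foldr-commMonoid)
  open import Algebra.Definitions.RawMonoid rawMonoid using () renaming (_×_ to _×ᵐ_)
  open import Data.List.Relation.Binary.Permutation.Setoid setoid using (_↭_)
  open PerfectMatchings setoid using (PerfectMatching; flatten)
  open import Relation.Binary.Reasoning.Setoid setoid

  prod : List Carrier → Carrier
  prod = foldr _∙_ ε

  _^_ : Carrier → ℕ → Carrier
  x ^ n = n ×ᵐ x

  prod-↭ : ∀ {xs ys} → xs ↭ ys → prod xs ≈ prod ys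
  prod-↭ = foldr-commMonoid isCommutativeMonoid

  prod-flatten : ∀ {z ps} → All (λ (x , y) → x ∙ y ≈ z) ps → prod (flatten ps) ≈ z ^ length ps
  prod-flatten []                       = refl
  prod-flatten {z} {(x , y) ∷ ps} (xy≈z ∷ eqs) = begin
    x ∙ (y ∙ prod (flatten ps)) ≈⟨ assoc x y _ ⟨
    (x ∙ y) ∙ prod (flatten ps) ≈⟨ ∙-cong xy≈z (prod-flatten eqs) ⟩
    z ∙ z ^ length ps           ∎

  prod-perfectMatching : ∀ {_~_ xs z} (m : PerfectMatching _~_ xs) → (∀ {x y} → x ~ y → x ∙ y ≈ z) →
                         prod xs ≈ z ^ length (PerfectMatching.pairs m)
  prod-perfectMatching m ~⇒≈z =
    trans (prod-↭ ↭-flatten) (prod-flatten (All.map ~⇒≈z matched))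
    where open PerfectMatching m

module Fields {c ℓ} (F : CommutativeRing c ℓ) (isField : IsField F) where
  open CommutativeRing F
  open import Data.Nat using () renaming (_^_ to _^ℕ_)
  open import Algebra.Properties.Ring ring
    using (-‿involutive; -‿distribˡ-*; -‿distribʳ-*; +-inverseʳ-unique; [y-z]x≈yx-zx; ⁻¹-anti-homo‿-; x∙y⁻¹≈ε⇒x≈y)
  open RingPowers F using (_^_; sign; [-1]^n≈sign[parity[n]]; x^Q≈-x⇒x^Qᵏ≈[-1]ᵏ*x)
  open import Relation.Binary.Reasoning.Setoid setoid

  0≉1 : 0# ≉ 1#
  0≉1 = proj₁ isField

  1≉0 : 1# ≉ 0#
  1≉0 = 0≉1 ∘ sym

  *-cancelˡ : ∀ {x y z} → x ≉ 0# → x * y ≈ x * z → y ≈ z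
  *-cancelˡ {x} {y} {z} x≉0 xy≈xz with x⁻¹ , xx⁻¹≈1 ← proj₂ isField x x≉0 = begin
    y               ≈⟨ *-identityˡ y ⟨
    1# * y          ≈⟨ *-congʳ (trans (*-comm x⁻¹ x) xx⁻¹≈1) ⟨
    (x⁻¹ * x) * y   ≈⟨ *-assoc x⁻¹ x y ⟩
    x⁻¹ * (x * y)   ≈⟨ *-congˡ xy≈xz ⟩
    x⁻¹ * (x * z)   ≈⟨ *-assoc x⁻¹ x z ⟨
    (x⁻¹ * x) * z   ≈⟨ *-congʳ (trans (*-comm x⁻¹ x) xx⁻¹≈1) ⟩
    1# * z          ≈⟨ *-identityˡ z ⟩
    z               ∎

  *-cancelʳ : ∀ {x y z} → x ≉ 0# → y * x ≈ z * x → y ≈ z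
  *-cancelʳ {x} {y} {z} x≉0 yx≈zx = *-cancelˡ x≉0 (trans (*-comm x y) (trans yx≈zx (*-comm z x)))

  x≉0∧xy≈0⇒y≈0 : ∀ {x y} → x ≉ 0# → x * y ≈ 0# → y ≈ 0#
  x≉0∧xy≈0⇒y≈0 {x} x≉0 xy≈0 = *-cancelˡ x≉0 (trans xy≈0 (sym (zeroʳ x)))

  x*y≉0 : ∀ {x y} → x ≉ 0# → y ≉ 0# → x * y ≉ 0#
  x*y≉0 x≉0 y≉0 = y≉0 ∘ x≉0∧xy≈0⇒y≈0 x≉0

  x*y≈z≉0⇒x≉0 : ∀ {x y z} → x * y ≈ z → z ≉ 0# → x ≉ 0#
  x*y≈z≉0⇒x≉0 {x} {y} xy≈z z≉0 x≈0 = z≉0 (trans (sym xy≈z) (trans (*-congʳ x≈0) (zeroˡ y)))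

  nonsquare⇒≉0 : ∀ {x} → ¬ IsSquare F x → x ≉ 0#
  nonsquare⇒≉0 ¬□x x≈0 = ¬□x (0# , trans (zeroˡ 0#) (sym x≈0))

  x^n≉0 : ∀ {x} n → x ≉ 0# → x ^ n ≉ 0#
  x^n≉0 zero    _   = 1≉0
  x^n≉0 (suc n) x≉0 = x*y≉0 x≉0 (x^n≉0 n x≉0)

  -x*-x≈x*x : ∀ x → - x * - x ≈ x * x
  -x*-x≈x*x x = begin
    - x * - x     ≈⟨ -‿distribˡ-* x (- x) ⟨
    - (x * - x)   ≈⟨ -‿cong (-‿distribʳ-* x x) ⟨
    - - (x * x)   ≈⟨ -‿involutive (x * x) ⟩
    x * x         ∎

  x*x≈y*y∧x≉y⇒x≈-y : ∀ {x y} → x * x ≈ y * y → x ≉ y → x ≈ - y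
  x*x≈y*y∧x≉y⇒x≈-y {x} {y} xx≈yy x≉y = +-inverseʳ-unique y x (x≉0∧xy≈0⇒y≈0 x-y≉0 (begin
    (x - y) * (y + x)                    ≈⟨ distribˡ (x - y) y x ⟩
    (x - y) * y + (x - y) * x            ≈⟨ +-cong ([y-z]x≈yx-zx y x y) ([y-z]x≈yx-zx x x y) ⟩
    (x * y - y * y) + (x * x - y * x)    ≈⟨ +-congˡ (+-cong xx≈yy (-‿cong (*-comm y x))) ⟩
    (x * y - y * y) + (y * y - x * y)    ≈⟨ +-congˡ (⁻¹-anti-homo‿- (x * y) (y * y)) ⟨
    (x * y - y * y) + - (x * y - y * y)  ≈⟨ -‿inverseʳ (x * y - y * y) ⟩
    0#                                   ∎))
    where
    x-y≉0 : x - y ≉ 0#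
    x-y≉0 = x≉y ∘ x∙y⁻¹≈ε⇒x≈y x y

  -1≉1 : 1# + 1# ≉ 0# → - 1# ≉ 1#
  -1≉1 2≉0 -1≈1 = 2≉0 (trans (+-congˡ (sym -1≈1)) (-‿inverseʳ 1#))

  -x≉x : 1# + 1# ≉ 0# → ∀ {x} → x ≉ 0# → - x ≉ x
  -x≉x 2≉0 {x} x≉0 -x≈x = -1≉1 2≉0 (*-cancelˡ x≉0 (begin
    x * - 1#    ≈⟨ -‿distribʳ-* x 1# ⟨
    - (x * 1#)  ≈⟨ -‿cong (*-identityʳ x) ⟩
    - x         ≈⟨ -x≈x ⟩
    x           ≈⟨ *-identityʳ x ⟨
    x * 1#      ∎))

  sign-injective : 1# + 1# ≉ 0# → ∀ {p p′} → sign p ≈ sign p′ → p ≡ p′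
  sign-injective _   {0ℙ} {0ℙ} _  = ≡.refl
  sign-injective 2≉0 {0ℙ} {1ℙ} eq = contradiction (sym eq) (-1≉1 2≉0)
  sign-injective 2≉0 {1ℙ} {0ℙ} eq = contradiction eq (-1≉1 2≉0)
  sign-injective _   {1ℙ} {1ℙ} _  = ≡.refl

  x^qˡ≈-x∧x^qᵈ≈-x⇒parity≡ : 1# + 1# ≉ 0# → ∀ {q x} l d → parity q ≡ 1ℙ → x ≉ 0# →
                             x ^ (q ^ℕ l) ≈ - x → x ^ (q ^ℕ d) ≈ - x → parity l ≡ parity d
  x^qˡ≈-x∧x^qᵈ≈-x⇒parity≡ 2≉0 {q} {x} l d odd-q x≉0 x^qˡ≈-x x^qᵈ≈-x =
    ≡.sym (sign-injective 2≉0 (begin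
      sign (parity d)    ≈⟨ [-1]^n≈sign[parity[n]] d ⟨
      (- 1#) ^ d         ≈⟨ *-cancelʳ x≉0 [-1]ᵈx≈[-1]ˡx ⟩
      (- 1#) ^ l         ≈⟨ [-1]^n≈sign[parity[n]] l ⟩
      sign (parity l)    ∎))
    where
    [-1]ᵈx≈[-1]ˡx : (- 1#) ^ d * x ≈ (- 1#) ^ l * x
    [-1]ᵈx≈[-1]ˡx = begin
      (- 1#) ^ d * x       ≈⟨ x^Q≈-x⇒x^Qᵏ≈[-1]ᵏ*x (parity-^ odd-q l) x^qˡ≈-x d ⟨
      x ^ ((q ^ℕ l) ^ℕ d)  ≡⟨ ≡.cong (x ^_) (qˡᵈ≡qᵈˡ q l d) ⟩
      x ^ ((q ^ℕ d) ^ℕ l)  ≈⟨ x^Q≈-x⇒x^Qᵏ≈[-1]ᵏ*x (parity-^ odd-q d) x^qᵈ≈-x l ⟩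
      (- 1#) ^ l * x       ∎

module OddOrderFields {c ℓ} (F : CommutativeRing c ℓ) (isField : IsField F) {h : ℕ} (card : HasCard F (suc (h ℕ.+ h))) where
  open CommutativeRing F
  import Data.Fin.Properties as Fin
  open import Data.Fin.Properties using (any?; ¬∀⟶∃¬)
  open import Data.List.Base using (List; _∷_; length; tabulate)
  open import Data.List.Properties using (length-tabulate)
  open import Data.List.Membership.Setoid.Properties using (∈-tabulate⁺; ∈-resp-≈)
  open import Data.List.Relation.Unary.Unique.Setoid.Properties using (tabulate⁺)
  open import Data.List.Relation.Binary.Permutation.Setoid setoid using (_↭_; ↭-prep; ↭-trans)
  open import Data.List.Relation.Binary.Permutation.Setoid.Properties setoid using (xs↭ys⇒|xs|≡|ys|)
  open import Data.Unit.Polymorphic using (⊤; tt)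
  open import Relation.Nullary.Decidable using (Dec; map′)
  open import Algebra.Properties.Ring ring using (-‿injective; -‿distribˡ-*; -‿distribʳ-*; +-cancelˡ)
  open import Algebra.Properties.Semiring.Exp semiring using (^-assocʳ)
  open RingPowers F using (_^_; 1^n≈1)
  open Fields F isField
  open PerfectMatchings setoid
  open MatchingProducts *-commutativeMonoid using (prod; prod-↭; prod-perfectMatching)
  open import Relation.Binary.Reasoning.Setoid setoid
  module I = Inverse card

  to-injective : ∀ {i j} → I.to i ≈ I.to j → i ≡ j
  to-injective {i} {j} eq = ≡.trans (≡.sym (I.strictlyInverseʳ i)) (≡.trans (I.from-cong eq) (I.strictlyInverseʳ j))

  from-injective : ∀ {x y} → I.from x ≡ I.from y → x ≈ y
  from-injective {x} {y} eq = trans (sym (I.strictlyInverseˡ x)) (trans (I.to-cong eq) (I.strictlyInverseˡ y))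

  elements : List Carrier
  elements = tabulate I.to

  elements-enumerates : Enumerates (λ _ → ⊤) elements
  elements-enumerates = record
    { unique   = tabulate⁺ setoid {f = I.to} to-injective
    ; sound    = λ _ → tt
    ; complete = λ {x} _ → ∈-resp-≈ setoid (I.strictlyInverseˡ x) (∈-tabulate⁺ setoid {f = I.to} (I.from x))
    }

  -- Otherwise x ↦ x + 1 would pair off the odd number of elements.
  1+1≉0 : 1# + 1# ≉ 0#
  1+1≉0 2≈0 = 1+n+n≢m+m h (length pairs) (≡.trans (≡.sym (length-tabulate I.to)) length≡)
    where
    _~_ : Rel Carrier ℓ
    x ~ y = y ≈ x + 1#

    ~-sym : Symmetric _~_
    ~-sym {x} {y} y≈x+1 = begin
      x               ≈⟨ +-identityʳ x ⟨
      x + 0#          ≈⟨ +-congˡ 2≈0 ⟨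
      x + (1# + 1#)   ≈⟨ +-assoc x 1# 1# ⟨
      (x + 1#) + 1#   ≈⟨ +-congʳ y≈x+1 ⟨
      y + 1#          ∎

    ~-irrefl : ∀ {x y} → x ~ y → x ≉ y
    ~-irrefl {x} y≈x+1 x≈y = 0≉1 (+-cancelˡ x 0# 1# (trans (+-identityʳ x) (trans x≈y y≈x+1)))

    shift-by-one : PerfectMatching _~_ elements
    shift-by-one = perfectMatching ~-sym (λ y≈x+1 z≈x+1 → trans y≈x+1 (sym z≈x+1)) ~-irrefl
                     (λ y≈y′ y≈x+1 → trans (sym y≈y′) y≈x+1) elements-enumerates (λ {x} _ → x + 1# , tt , refl)

    open PerfectMatching shift-by-one

  private
    removal-of-0 : ∃ λ ys → elements ↭ 0# ∷ ys × Enumerates (λ z → ⊤ × z ≉ 0#) ys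
    removal-of-0 = enumerates-remove elements-enumerates tt

  nonzeros : List Carrier
  nonzeros = proj₁ removal-of-0

  nonzeros-enumerates : Enumerates (_≉ 0#) nonzeros
  nonzeros-enumerates = enumerates-≐ (proj₂ , (tt ,_)) (proj₂ (proj₂ removal-of-0))

  length-nonzeros : length nonzeros ≡ h ℕ.+ h
  length-nonzeros = ℕₚ.suc-injective (≡.trans (≡.sym (xs↭ys⇒|xs|≡|ys| (proj₁ (proj₂ removal-of-0)))) (length-tabulate I.to))

  module Complements {β} (β≉0 : β ≉ 0#) where
    _~_ : Rel Carrier ℓ
    x ~ y = x * y ≈ β × x * x ≉ β

    ~-sym : Symmetric _~_
    ~-sym {x} {y} (xy≈β , xx≉β) = yx≈β , λ yy≈β → xx≉β (trans (*-cong (sym (y≈x yy≈β)) (sym (y≈x yy≈β))) yy≈β)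
      where
      yx≈β : y * x ≈ β
      yx≈β = trans (*-comm y x) xy≈β
      y≈x : y * y ≈ β → y ≈ x
      y≈x yy≈β = *-cancelˡ (x*y≈z≉0⇒x≉0 yx≈β β≉0) (trans yy≈β (sym yx≈β))

    ~-functional : ∀ {x y z} → x ~ y → x ~ z → y ≈ z
    ~-functional (xy≈β , _) (xz≈β , _) = *-cancelˡ (x*y≈z≉0⇒x≉0 xy≈β β≉0) (trans xy≈β (sym xz≈β))

    ~-irrefl : ∀ {x y} → x ~ y → x ≉ y
    ~-irrefl (xy≈β , xx≉β) x≈y = xx≉β (trans (*-congˡ x≈y) xy≈β)

    ~-respʳ : _~_ Respectsʳ _≈_
    ~-respʳ y≈y′ (xy≈β , xx≉β) = trans (*-congˡ (sym y≈y′)) xy≈β , xx≉β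

    NonRoot : Pred Carrier ℓ
    NonRoot x = x ≉ 0# × x * x ≉ β

    nonRoots-closed : Closed _~_ NonRoot
    nonRoots-closed {x} (x≉0 , xx≉β) with x⁻¹ , xx⁻¹≈1 ← proj₂ isField x x≉0 =
      β * x⁻¹ , (x*y≉0 β≉0 x⁻¹≉0 , proj₂ (~-sym x~βx⁻¹)) , x~βx⁻¹
      where
      x⁻¹≉0 : x⁻¹ ≉ 0#
      x⁻¹≉0 = x*y≈z≉0⇒x≉0 (trans (*-comm x⁻¹ x) xx⁻¹≈1) 1≉0
      x~βx⁻¹ : x ~ (β * x⁻¹)
      x~βx⁻¹ = (begin
        x * (β * x⁻¹)   ≈⟨ *-assoc x β x⁻¹ ⟨
        (x * β) * x⁻¹   ≈⟨ *-congʳ (*-comm x β) ⟩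
        (β * x) * x⁻¹   ≈⟨ *-assoc β x x⁻¹ ⟩
        β * (x * x⁻¹)   ≈⟨ *-congˡ xx⁻¹≈1 ⟩
        β * 1#          ≈⟨ *-identityʳ β ⟩
        β               ∎) , xx≉β

    prod-nonRoots : ∀ {xs} → Enumerates NonRoot xs → ∃ λ k → length xs ≡ k ℕ.+ k × prod xs ≈ β ^ k
    prod-nonRoots e = length pairs , length≡ , prod-perfectMatching matching proj₁
      where
      matching = perfectMatching ~-sym ~-functional ~-irrefl ~-respʳ e nonRoots-closed
      open PerfectMatching matching

  prod-nonzeros-nonsquare : ∀ {β} → ¬ IsSquare F β → prod nonzeros ≈ β ^ h
  prod-nonzeros-nonsquare {β} ¬□β
    with k , |xs|≡k+k , prod≈βᵏ ← Complements.prod-nonRoots (nonsquare⇒≉0 ¬□β)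
                                   (enumerates-≐ ((λ x≉0 → x≉0 , λ xx≈β → ¬□β (_ , xx≈β)) , proj₁) nonzeros-enumerates)
    = ≡.subst (λ n → prod nonzeros ≈ β ^ n) (n+n≡m+m⇒n≡m {k} {h} (≡.trans (≡.sym |xs|≡k+k) length-nonzeros)) prod≈βᵏ

  module _ {β γ} (β≉0 : β ≉ 0#) (γγ≈β : γ * γ ≈ β) where
    open Complements β≉0 using (NonRoot; prod-nonRoots)

    private
      γ≉0 : γ ≉ 0#
      γ≉0 = x*y≈z≉0⇒x≉0 γγ≈β β≉0

      -γ≉0 : - γ ≉ 0#
      -γ≉0 = x*y≈z≉0⇒x≉0 (trans (-x*-x≈x*x γ) γγ≈β) β≉0

      ≉±γ⇔NonRoot : (λ z → (z ≉ 0# × z ≉ γ) × z ≉ - γ) ≐ NonRoot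
      ≉±γ⇔NonRoot = (λ ((z≉0 , z≉γ) , z≉-γ) → z≉0 , λ zz≈β → z≉-γ (x*x≈y*y∧x≉y⇒x≈-y (trans zz≈β (sym γγ≈β)) z≉γ))
                  , (λ (z≉0 , zz≉β) → (z≉0 , λ z≈γ → zz≉β (trans (*-cong z≈γ z≈γ) γγ≈β))
                                     , λ z≈-γ → zz≉β (trans (*-cong z≈-γ z≈-γ) (trans (-x*-x≈x*x γ) γγ≈β)))

      removing-±γ⇒prod≈-β^h : ∀ {ys zs} → nonzeros ↭ γ ∷ ys → ys ↭ - γ ∷ zs →
                  Enumerates (λ z → (z ≉ 0# × z ≉ γ) × z ≉ - γ) zs → prod nonzeros ≈ - (β ^ h)
      removing-±γ⇒prod≈-β^h {ys} {zs} nonzeros↭γ∷ys ys↭-γ∷zs ±γ-removed =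
        let k , |zs|≡k+k , prod≈βᵏ = prod-nonRoots (enumerates-≐ ≉±γ⇔NonRoot ±γ-removed)
            nonzeros↭ = ↭-trans nonzeros↭γ∷ys (↭-prep γ ys↭-γ∷zs)
            h≡1+k : h ≡ suc k
            h≡1+k = n+n≡m+m⇒n≡m {h} {suc k} (≡.trans (≡.sym length-nonzeros)
              (≡.trans (xs↭ys⇒|xs|≡|ys| nonzeros↭) (≡.cong suc (≡.trans (≡.cong suc |zs|≡k+k) (≡.sym (ℕₚ.+-suc k k))))))
        in begin
        prod nonzeros          ≈⟨ prod-↭ nonzeros↭ ⟩
        γ * (- γ * prod zs)    ≈⟨ *-assoc γ (- γ) (prod zs) ⟨
        (γ * - γ) * prod zs    ≈⟨ *-cong (trans (sym (-‿distribʳ-* γ γ)) (-‿cong γγ≈β)) prod≈βᵏ ⟩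
        - β * β ^ k            ≈⟨ -‿distribˡ-* β (β ^ k) ⟨
        - (β ^ suc k)          ≡⟨ ≡.cong (λ n → - (β ^ n)) h≡1+k ⟨
        - (β ^ h)              ∎

    prod-nonzeros-square : prod nonzeros ≈ - (β ^ h)
    prod-nonzeros-square =
      let ys , nonzeros↭γ∷ys , γ-removed = enumerates-remove nonzeros-enumerates γ≉0
          zs , ys↭-γ∷zs , ±γ-removed = enumerates-remove γ-removed (-γ≉0 , -x≉x 1+1≉0 γ≉0)
      in removing-±γ⇒prod≈-β^h nonzeros↭γ∷ys ys↭-γ∷zs ±γ-removed

  wilson : prod nonzeros ≈ - 1#
  wilson = trans (prod-nonzeros-square 1≉0 (*-identityˡ 1#)) (-‿cong (1^n≈1 h))

  euler-square : ∀ {β} → β ≉ 0# → IsSquare F β → β ^ h ≈ 1#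
  euler-square β≉0 (γ , γγ≈β) = -‿injective (trans (sym (prod-nonzeros-square β≉0 γγ≈β)) wilson)

  euler-nonsquare : ∀ {β} → ¬ IsSquare F β → β ^ h ≈ - 1#
  euler-nonsquare ¬□β = trans (sym (prod-nonzeros-nonsquare ¬□β)) wilson

  β^h≉1⇔nonsquare : ∀ {β} → β ≉ 0# → (β ^ h ≉ 1#) ⇔ (¬ IsSquare F β)
  β^h≉1⇔nonsquare β≉0 = mk⇔ (λ β^h≉1 □β → β^h≉1 (euler-square β≉0 □β))
                            (λ ¬□β β^h≈1 → -1≉1 1+1≉0 (trans (sym (euler-nonsquare ¬□β)) β^h≈1))

  -- Chosen square roots would inject the field into itself missing - r₁, where r₁ is the root chosen
  -- for 1: a root equal to - r₁ squares to 1, so it is r₁ itself, but - r₁ ≉ r₁.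
  ¬-all-squares : ¬ (∀ y → IsSquare F y)
  ¬-all-squares □ = injective⇒¬avoids {f = I.from ∘ root} root-injective (I.from (- r₁)) avoids-−r₁
    where
    root : Fin (suc (h ℕ.+ h)) → Carrier
    root i = proj₁ (□ (I.to i))
    root² : ∀ i → root i * root i ≈ I.to i
    root² i = proj₂ (□ (I.to i))
    root-injective : ∀ {i j} → I.from (root i) ≡ I.from (root j) → i ≡ j
    root-injective {i} {j} eq = to-injective (trans (sym (root² i)) (trans (*-cong rᵢ≈rⱼ rᵢ≈rⱼ) (root² j)))
      where rᵢ≈rⱼ = from-injective eq
    r₁ : Carrier
    r₁ = root (I.from 1#)
    r₁≉0 : r₁ ≉ 0#
    r₁≉0 = x*y≈z≉0⇒x≉0 (trans (root² (I.from 1#)) (I.strictlyInverseˡ 1#)) 1≉0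
    avoids-−r₁ : ∀ i → I.from (root i) ≢ I.from (- r₁)
    avoids-−r₁ i eq = -x≉x 1+1≉0 r₁≉0 (sym (≡.subst (λ j → root j ≈ - r₁) i≡i₁ rᵢ≈-r₁))
      where
      rᵢ≈-r₁ = from-injective eq
      i≡i₁ : i ≡ I.from 1#
      i≡i₁ = to-injective (begin
        I.to i              ≈⟨ root² i ⟨
        root i * root i     ≈⟨ *-cong rᵢ≈-r₁ rᵢ≈-r₁ ⟩
        - r₁ * - r₁         ≈⟨ -x*-x≈x*x r₁ ⟩
        r₁ * r₁             ≈⟨ root² (I.from 1#) ⟩
        I.to (I.from 1#)    ∎)

  infix 4 _≟_
  _≟_ : ∀ x y → Dec (x ≈ y)
  x ≟ y = map′ from-injective I.from-cong (I.from x Fin.≟ I.from y)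

  isSquare? : ∀ y → Dec (IsSquare F y)
  isSquare? y = map′ (λ (i , ii≈y) → I.to i , ii≈y)
                     (λ (γ , γγ≈y) → I.from γ , trans (*-cong (I.strictlyInverseˡ γ) (I.strictlyInverseˡ γ)) γγ≈y)
                     (any? λ i → I.to i * I.to i ≟ y)

  ∃-nonsquare : ∃ λ η → ¬ IsSquare F η
  ∃-nonsquare =
    let i , ¬□ = ¬∀⟶∃¬ _ (IsSquare F ∘ I.to) (isSquare? ∘ I.to) (λ □ → ¬-all-squares λ y → square (□ (I.from y)))
    in I.to i , ¬□
    where
    square : ∀ {y} → IsSquare F (I.to (I.from y)) → IsSquare F y
    square {y} (γ , γγ≈y) = γ , trans γγ≈y (I.strictlyInverseˡ y)

  ∃a^[1+Q]≈-a : ∀ {Q e} → h ≡ e ℕ.* Q → ∃ λ a → a ≉ 0# × a ^ suc Q ≈ - a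
  ∃a^[1+Q]≈-a {Q} {e} h≡eQ = η ^ e , x^n≉0 e (nonsquare⇒≉0 ¬□η) , (begin
    η ^ e * (η ^ e) ^ Q  ≈⟨ *-congˡ (trans (^-assocʳ η e Q) (trans (reflexive (≡.cong (η ^_) (≡.sym h≡eQ))) (euler-nonsquare ¬□η))) ⟩
    η ^ e * - 1#         ≈⟨ -‿distribʳ-* (η ^ e) 1# ⟨
    - (η ^ e * 1#)       ≈⟨ -‿cong (*-identityʳ (η ^ e)) ⟩
    - (η ^ e)            ∎)
    where
    η = proj₁ ∃-nonsquare
    ¬□η = proj₂ ∃-nonsquare

open import Data.Nat using (_+_; _*_; _^_; _%_; _<_)

module FieldOfOrderQ^2l {c ℓ} (q : ℕ) (odd-q : parity q ≡ 1ℙ) (l d : ℕ)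
                        (F : CommutativeRing c ℓ) (isField : IsField F) (card : HasCard F (q ^ (2 * l))) where
  private
    module F = CommutativeRing F
    open RingPowers F using (pow≡^; sign; [-1]^n≈sign[parity[n]]; x^Q≈-x⇒x^Qᵏ≈[-1]ᵏ*x) renaming (_^_ to _^ᶠ_)
    open Fields F isField using (x^qˡ≈-x∧x^qᵈ≈-x⇒parity≡)
    open import Algebra.Properties.Ring F.ring using (+-inverseʳ-unique; -1*x≈-x)
    open import Data.Nat using (_∸_; _/_; ≢-nonZero)
    open import Data.Nat.DivMod using (/-congʳ; m*n/n≡m)
    open import Data.Nat.Divisibility using (∣1⇒≡1)
    open import Data.Nat.GCD using (gcd[m,n]≢0; gcd-greatest)
    open import Data.Sum using (inj₁)

    s : ℕ
    s = proj₁ (parity≡1ℙ⇒≡1+s+s q odd-q)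

    q≡1+2s : q ≡ suc (s + s)
    q≡1+2s = proj₂ (parity≡1ℙ⇒≡1+s+s q odd-q)

    e : ℕ
    e = proj₁ ([1+s+s]^[2*l]≡1+h+h s l)

  h : ℕ
  h = e * (s + s)

  |F|≡1+2h : q ^ (2 * l) ≡ suc (h + h)
  |F|≡1+2h = ≡.trans (≡.cong (_^ (2 * l)) q≡1+2s) (proj₂ ([1+s+s]^[2*l]≡1+h+h s l))

  open OddOrderFields F isField {h} (≡.subst (HasCard F) |F|≡1+2h card)
    using (1+1≉0; β^h≉1⇔nonsquare; ∃a^[1+Q]≈-a)

  a+aⁿ≈0⇒aⁿ≈-a : ∀ {a} n → a F.+ pow F a n F.≈ F.0# → a ^ᶠ n F.≈ F.- a
  a+aⁿ≈0⇒aⁿ≈-a {a} n a+aⁿ≈0 = +-inverseʳ-unique a _ (≡.subst (λ x → a F.+ x F.≈ F.0#) (pow≡^ a n) a+aⁿ≈0)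

  aⁿ≈-a⇒a+aⁿ≈0 : ∀ {a} n → a ^ᶠ n F.≈ F.- a → a F.+ pow F a n F.≈ F.0#
  aⁿ≈-a⇒a+aⁿ≈0 {a} n aⁿ≈-a = F.trans (F.+-congˡ (F.trans (F.reflexive (pow≡^ a n)) aⁿ≈-a)) (F.-‿inverseʳ a)

  ExistsA⇒parity≡ : ExistsA F q l d → parity l ≡ parity d
  ExistsA⇒parity≡ (a , a≉0 , a+a^qˡ≈0 , a+a^qᵈ≈0) =
    x^qˡ≈-x∧x^qᵈ≈-x⇒parity≡ 1+1≉0 l d odd-q a≉0 (a+aⁿ≈0⇒aⁿ≈-a (q ^ l) a+a^qˡ≈0) (a+aⁿ≈0⇒aⁿ≈-a (q ^ d) a+a^qᵈ≈0)

  odd∧odd⇒ExistsA : parity l ≡ 1ℙ → parity d ≡ 1ℙ → ExistsA F q l d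
  odd∧odd⇒ExistsA odd-l odd-d = a , a≉0 , aⁿ≈-a⇒a+aⁿ≈0 (q ^ l) (a^qᵏ≈-a {l} odd-l) , aⁿ≈-a⇒a+aⁿ≈0 (q ^ d) (a^qᵏ≈-a {d} odd-d)
    where
    witness = ∃a^[1+Q]≈-a {Q = s + s} {e = e} ≡.refl
    a = proj₁ witness
    a≉0 = proj₁ (proj₂ witness)
    a^q≈-a : a ^ᶠ q F.≈ F.- a
    a^q≈-a = ≡.subst (λ n → a ^ᶠ n F.≈ F.- a) (≡.sym q≡1+2s) (proj₂ (proj₂ witness))
    a^qᵏ≈-a : ∀ {k} → parity k ≡ 1ℙ → a ^ᶠ (q ^ k) F.≈ F.- a
    a^qᵏ≈-a {k} odd-k = F.trans (x^Q≈-x⇒x^Qᵏ≈[-1]ᵏ*x odd-q a^q≈-a k)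
      (F.trans (F.*-congʳ (F.trans ([-1]^n≈sign[parity[n]] k) (F.reflexive (≡.cong sign odd-k)))) (-1*x≈-x a))

  ¬ExistsA⇒parity≢ : gcd l d ≡ 1 → ¬ ExistsA F q l d → parity l ≢ parity d
  ¬ExistsA⇒parity≢ gcd≡1 ¬∃ l≡d with parity l in eq-l
  ... | 0ℙ = contradiction (∣1⇒≡1 (≡.subst (2 ∣_) gcd≡1 2∣gcd)) λ ()
    where 2∣gcd = gcd-greatest (parity≡0ℙ⇒2∣ l eq-l) (parity≡0ℙ⇒2∣ d (≡.sym l≡d))
  ... | 1ℙ = ¬∃ (odd∧odd⇒ExistsA eq-l (≡.sym l≡d))

  ¬ExistsA⇔parity≢ : gcd l d ≡ 1 → (¬ ExistsA F q l d) ⇔ (parity l ≢ parity d)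
  ¬ExistsA⇔parity≢ gcd≡1 = mk⇔ (¬ExistsA⇒parity≢ gcd≡1) (λ l≢d → l≢d ∘ ExistsA⇒parity≡)

  expo≡h : parity l ≢ parity d → expo q l d ≡ h
  expo≡h l≢d = begin
    expo q l d                 ≡⟨ /-congʳ ⦃ ≢-nonZero (gcd[m,n]≢0 (suc (q ^ l)) (suc (q ^ d)) (inj₁ λ ())) ⦄ (gcd[1+qˡ,1+qᵈ]≡2 l d odd-q l≢d) ⟩
    (q ^ (2 * l) ∸ 1) / 2      ≡⟨ ≡.cong (λ n → (n ∸ 1) / 2) |F|≡1+2h ⟩
    (h + h) / 2                ≡⟨ ≡.cong (_/ 2) (≡.trans (≡.cong (h +_) (≡.sym (ℕₚ.+-identityʳ h))) (ℕₚ.*-comm 2 h)) ⟩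
    h * 2 / 2                  ≡⟨ m*n/n≡m h 2 ⟩
    h                          ∎
    where open ≡.≡-Reasoning

  β^expo≉1⇔nonsquare : gcd l d ≡ 1 → ¬ ExistsA F q l d → ∀ β → ¬ β F.≈ F.0# →
                       (¬ pow F β (expo q l d) F.≈ F.1#) ⇔ (¬ IsSquare F β)
  β^expo≉1⇔nonsquare gcd≡1 ¬∃ β β≉0
    rewrite expo≡h (Equivalence.to (¬ExistsA⇔parity≢ gcd≡1) ¬∃) | pow≡^ β h = β^h≉1⇔nonsquare β≉0

-- Only the oddness of q and gcd (l, d) = 1 are needed: that q is a prime power and the bounds on l and d are unused.
lemma3p1 : {c ℓ' : Level} (q : ℕ) → IsPrimePower q → ¬ (2 ∣ q) → (l d : ℕ) → 0 < l → 0 < d → d < 2 * l → gcd l d ≡ 1 → (R : CommutativeRing c ℓ') → IsField R → HasCard R (q ^ (2 * l)) → ((¬ ExistsA R q l d) ⇔ ((l + d) % 2 ≡ 1)) × ((¬ ExistsA R q l d) → ∀ β → ¬ (CommutativeRing._≈_ R β (CommutativeRing.0# R)) → ((¬ (CommutativeRing._≈_ R (pow R β (expo q l d)) (CommutativeRing.1# R))) ⇔ (¬ IsSquare R β)))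
lemma3p1 q _ 2∤q l d _ _ _ gcd≡1 R isField card =
  ⇔-trans (¬ExistsA⇔parity≢ gcd≡1) (⇔-sym ([m+n]%2≡1⇔parity≢ l d)) , β^expo≉1⇔nonsquare gcd≡1
  where
  open FieldOfOrderQ^2l q (¬2∣⇒parity≡1ℙ q 2∤q) l d R isField card
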